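{- Let $\Omega$ and $A$ be sets, $(T,\eta,\mu)$ a monad on $\mathbf{Sets}$ and $t\colon T(\Omega)\to\Omega$ an Eilenberg-Moore algebra. Let $B(X)=\Omega\times X^A$, and define $\kappa_X=(t\times\mathrm{st})\circ\langle T(\pi_1),T(\pi_2)\rangle\colon T(\Omega\times X^A)\to\Omega\times T(X)^A$, $\tau_X=t^X\circ\mathrm{st}\colon T(\Omega^X)\to\Omega^X$, and $\delta_X\colon\Omega\times(\Omega^X)^A\to\Omega^{A\times X+1}$ by $\delta_X(\omega,g)(\ast)=\omega$ and $\delta_X(\omega,g)(a,x)=g(a)(x)$. Then $\delta_X\circ(\mathrm{id}\times(\tau_X)^A)\circ\kappa_{\Omega^X}=\tau_{A\times X+1}\circ T(\delta_X)$ for every set $X$. Moreover, there is a bijection $\mathsf{e}\colon\Omega^{A^*}\to\Omega^{A^*}$ such that for every coalgebra $c=\langle o,f\rangle\colon X\to\Omega\times T(X)^A$ we have $\mathsf{e}\circ\mathsf{em}_c=\mathsf{log}_c$, where: $\mathsf{em}_c\colon X\to\Omega^{A^*}$ is the unique map with $\mathsf{em}_c=\zeta^{ -1}\circ B(a)\circ BT(\mathsf{em}_c)\circ c$, for $\zeta\colon\Omega^{A^*}\to\Omega\times(\Omega^{A^*})^A$, $\zeta(\varphi)=(\varphi(\varepsilon),\lambda b.\lambda w.\varphi(bw))$ and $a=t^{A^*}\circ\mathrm{st}\colon T(\Omega^{A^*})\to\Omega^{A^*}$; and $\mathsf{log}_c\colon X\to\Omega^{A^*}$ is the unique map with $\mathsf{log}_c(x)(\varepsilon)=o(x)$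 and $\mathsf{log}_c(x)(bw)=t\big(T(\mathrm{ev}_w\circ\mathsf{log}_c)(f(x)(b))\big)$.
   Context: $\mathrm{st}$ denotes the canonical strength of a functor $S$ on $\mathbf{Sets}$: $\mathrm{st}\colon S(Y^Z)\to S(Y)^Z$, $\mathrm{st}(u)(z)=S(\mathrm{ev}_z)(u)$, with $\mathrm{ev}_z(g)=g(z)$. $A^*$ is the set of finite words over $A$, $\varepsilon$ the empty word; $1=\{\ast\}$. $t^X\colon T(\Omega)^X\to\Omega^X$ is postcomposition with $t$. The map $\kappa$ is an Eilenberg-Moore law $TB\Rightarrow BT$, $(\Omega^{A^*},\zeta)$ is a final $B$-coalgebra, and the maps $\mathsf{em}_c$, $\mathsf{log}_c$ described exist and are unique. -}

module Defs where

open import Data.Product using (Σ; _×_; _,_; proj₁; proj₂)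
open import Data.Sum using (_⊎_; inj₁; inj₂)
open import Data.Unit using (⊤; tt)
open import Data.List using (List; []; _∷_)
open import Relation.Binary.PropositionalEquality using (_≡_)
open import Function using (_∘_; id)

-- Equalities of maps are stated
-- pointwise (no function extensionality in --safe Agda); accordingly the
-- functor action is required to respect pointwise equality of maps.
record Monad : Set₁ where
  field
    T     : Set → Set
    fmap  : ∀ {X Y : Set} → (X → Y) → T X → T Y
    η     : ∀ {X : Set} → X → T X
    μ     : ∀ {X : Set} → T (T X) → T X
    fmap-cong : ∀ {X Y : Set} {f g : X → Y} → (∀ x → f x ≡ g x) →
                ∀ u → fmap f u ≡ fmap g u
    fmap-id   : ∀ {X : Set} (u : T X) → fmap id u ≡ u
    fmap-∘    : ∀ {X Y Z : Set} (g : Y → Z) (f : X → Y) (u : T X) →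
                fmap (g ∘ f) u ≡ fmap g (fmap f u)
    η-nat     : ∀ {X Y : Set} (f : X → Y) (x : X) → fmap f (η x) ≡ η (f x)
    μ-nat     : ∀ {X Y : Set} (f : X → Y) (u : T (T X)) →
                fmap f (μ u) ≡ μ (fmap (fmap f) u)
    μ-ηT      : ∀ {X : Set} (u : T X) → μ (η u) ≡ u
    μ-Tη      : ∀ {X : Set} (u : T X) → μ (fmap η u) ≡ u
    μ-assoc   : ∀ {X : Set} (u : T (T (T X))) → μ (μ u) ≡ μ (fmap μ u)

record IsEMAlgebra (M : Monad) {Ω : Set} (t : Monad.T M Ω → Ω) : Set where
  open Monad M
  field
    unit : ∀ (ω : Ω) → t (η ω) ≡ ω
    mult : ∀ (u : T (T Ω)) → t (μ u) ≡ t (fmap t u)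

record IsBijection {A Ω : Set} (e : (List A → Ω) → (List A → Ω)) : Set where
  field
    inv      : (List A → Ω) → (List A → Ω)
    e-cong   : ∀ φ ψ → (∀ w → φ w ≡ ψ w) → ∀ w → e φ w ≡ e ψ w
    inv-cong : ∀ φ ψ → (∀ w → φ w ≡ ψ w) → ∀ w → inv φ w ≡ inv ψ w
    e-inv    : ∀ φ w → e (inv φ) w ≡ φ w
    inv-e    : ∀ φ w → inv (e φ) w ≡ φ w

module Constructions (M : Monad) {Ω A : Set} (t : Monad.T M Ω → Ω) where
  open Monad M

  ev : ∀ {Y Z : Set} → Z → (Z → Y) → Y
  ev z g = g z

  st : ∀ {Y Z : Set} → T (Z → Y) → Z → T Y
  st u z = fmap (ev z) u

  B : Set → Set
  B X = Ω × (A → X)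

  Bmap : ∀ {X Y : Set} → (X → Y) → B X → B Y
  Bmap f (ω , g) = ω , (λ a → f (g a))

  tpow : ∀ {X : Set} → (X → T Ω) → X → Ω
  tpow φ = t ∘ φ

  κ : ∀ {X : Set} → T (Ω × (A → X)) → Ω × (A → T X)
  κ u = t (fmap proj₁ u) , st (fmap proj₂ u)

  τ : ∀ {X : Set} → T (X → Ω) → X → Ω
  τ v = tpow (st v)

  δ : ∀ {X : Set} → Ω × (A → X → Ω) → (A × X) ⊎ ⊤ → Ω
  δ (ω , g) (inj₂ tt)      = ω
  δ (ω , g) (inj₁ (a , x)) = g a x

  idτA : ∀ {X : Set} → Ω × (A → T (X → Ω)) → Ω × (A → X → Ω)
  idτA (ω , h) = ω , (λ a → τ (h a))

  ζ : (List A → Ω) → Ω × (A → List A → Ω)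
  ζ φ = φ [] , (λ b w → φ (b ∷ w))

  ζ⁻¹ : Ω × (A → List A → Ω) → List A → Ω
  ζ⁻¹ (ω , g) []      = ω
  ζ⁻¹ (ω , g) (b ∷ w) = g b w

  alg : T (List A → Ω) → List A → Ω
  alg u = tpow (st u)

  IsEm : ∀ {X : Set} → (X → Ω × (A → T X)) → (X → List A → Ω) → Set
  IsEm c em = ∀ x w → em x w ≡ ζ⁻¹ (Bmap alg (Bmap (fmap em) (c x))) w

  IsLog : ∀ {X : Set} → (X → Ω × (A → T X)) → (X → List A → Ω) → Set
  IsLog c lg = (∀ x → lg x [] ≡ proj₁ (c x))
             × (∀ x b w → lg x (b ∷ w) ≡ t (fmap (ev w ∘ lg) (proj₂ (c x) b)))

-- Both sides of the interchange law are t applied to T(h)(u) for the same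
-- component map h of Ω × (Ω^X)^A, so it follows from functoriality alone.
-- Unfolding em_c's equation through ζ⁻¹ and the strength shows that em_c
-- satisfies the two equations defining log_c; these determine a map uniquely
-- by induction on words, so e can be taken to be the identity.
module Submission where

open import Defs
open import Data.Product using (Σ; _×_; _,_; proj₂)
open import Data.Sum using (_⊎_; inj₁; inj₂)
open import Data.Unit using (⊤; tt)
open import Data.List using (List; []; _∷_)
open import Relation.Binary.PropositionalEquality using (_≡_; refl; trans; sym; cong; module ≡-Reasoning)
open import Function using (id)

module _ (M : Monad) {Ω A : Set} (t : Monad.T M Ω → Ω) where
  open Monad M
  open Constructions M {Ω} {A} t
  open ≡-Reasoning

  δ∘idτA∘κ≗τ∘Tδ : ∀ {X : Set} (u : T (Ω × (A → X → Ω))) (y : (A × X) ⊎ ⊤) →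
                  δ (idτA (κ u)) y ≡ τ (fmap δ u) y
  δ∘idτA∘κ≗τ∘Tδ u (inj₂ tt) = cong t (fmap-∘ (ev (inj₂ tt)) δ u)
  δ∘idτA∘κ≗τ∘Tδ u (inj₁ (a , x)) = cong t (begin
    fmap (ev x) (fmap (ev a) (fmap proj₂ u))  ≡⟨ sym (fmap-∘ (ev x) (ev a) (fmap proj₂ u)) ⟩
    fmap (λ g → g a x) (fmap proj₂ u)         ≡⟨ sym (fmap-∘ (λ g → g a x) proj₂ u) ⟩
    fmap (λ p → proj₂ p a x) u                ≡⟨ fmap-∘ (ev (inj₁ (a , x))) δ u ⟩
    fmap (ev (inj₁ (a , x))) (fmap δ u)       ∎)

  module _ {X : Set} (c : X → Ω × (A → T X)) where

    IsEm⇒IsLog : ∀ {em : X → List A → Ω} → IsEm c em → IsLog c em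
    IsEm⇒IsLog {em} isEm = (λ x → isEm x []) , λ x b w → begin
      em x (b ∷ w)                                 ≡⟨ isEm x (b ∷ w) ⟩
      t (fmap (ev w) (fmap em (proj₂ (c x) b)))    ≡⟨ cong t (sym (fmap-∘ (ev w) em (proj₂ (c x) b))) ⟩
      t (fmap (λ y → em y w) (proj₂ (c x) b))      ∎

    IsLog-unique : ∀ {f g : X → List A → Ω} → IsLog c f → IsLog c g →
                   ∀ x w → f x w ≡ g x w
    IsLog-unique (f[] , _) (g[] , _) x [] = trans (f[] x) (sym (g[] x))
    IsLog-unique {f} {g} isLogf@(_ , f∷) isLogg@(_ , g∷) x (b ∷ w) = begin
      f x (b ∷ w)                             ≡⟨ f∷ x b w ⟩
      t (fmap (λ y → f y w) (proj₂ (c x) b))  ≡⟨ cong t (fmap-cong (λ y → IsLog-unique isLogf isLogg y w) (proj₂ (c x) b)) ⟩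
      t (fmap (λ y → g y w) (proj₂ (c x) b))  ≡⟨ sym (g∷ x b w) ⟩
      g x (b ∷ w)                             ∎

id-isBijection : ∀ {A Ω : Set} → IsBijection {A} {Ω} id
id-isBijection = record
  { inv      = id
  ; e-cong   = λ _ _ φ≗ψ → φ≗ψ
  ; inv-cong = λ _ _ φ≗ψ → φ≗ψ
  ; e-inv    = λ _ _ → refl
  ; inv-e    = λ _ _ → refl
  }

theorem7p6 : (Ω A : Set) (M : Monad) (t : Monad.T M Ω → Ω) → IsEMAlgebra M t →
  let open Monad M
      open Constructions M {Ω} {A} t
  in (∀ (X : Set) (u : T (Ω × (A → X → Ω))) (y : (A × X) ⊎ ⊤) →
        δ (idτA (κ u)) y ≡ τ (fmap δ u) y)
     × Σ ((List A → Ω) → (List A → Ω)) (λ e → IsBijection e ×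
         (∀ (X : Set) (c : X → Ω × (A → T X)) (em lg : X → List A → Ω) →
            IsEm c em → IsLog c lg → ∀ x w → e (em x) w ≡ lg x w))
theorem7p6 Ω A M t _ =
    (λ _ → δ∘idτA∘κ≗τ∘Tδ M t)
  , id
  , id-isBijection
  , λ _ c _ _ isEm isLog → IsLog-unique M t c (IsEm⇒IsLog M t c isEm) isLog
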